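{- For every even nonnegative integer $p$ there exists a finite tree $T$ with $Mo(T)=p$.
   Context: For a connected graph $G$ and an edge $uv\in E(G)$, let $n_u$ be the number of vertices of $G$ strictly closer (in shortest-path distance) to $u$ than to $v$, and $n_v$ analogously. The Mostar index is $Mo(G)=\sum_{uv\in E(G)}|n_u-n_v|$. -}

module Defs where

open import Data.Bool using (Bool; true; false; _∨_; _∧_; if_then_else_)
open import Data.Nat using (ℕ; zero; suc; _+_; _≤_; _<ᵇ_; ∣_-_∣)
open import Data.Fin using (Fin; toℕ)
open import Data.Fin.Properties using (_≟_)
open import Data.List using (List; []; _∷_; _++_; [_]; length; map; allFin; concatMap)
open import Data.Nat.ListAction using (sum)
open import Data.List.Relation.Unary.Unique.Propositional using (Unique)
open import Data.Product using (Σ; _×_; ∃)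
open import Data.Unit using (⊤)
open import Relation.Nullary using (¬_)
open import Relation.Nullary.Decidable using (⌊_⌋)
open import Relation.Binary.PropositionalEquality using (_≡_)

record Graph (n : ℕ) : Set where
  field
    adj    : Fin n → Fin n → Bool
    sym    : ∀ i j → adj i j ≡ adj j i
    irrefl : ∀ i → adj i i ≡ false
open Graph public

module _ {n : ℕ} (G : Graph n) where

  data Walk : Fin n → Fin n → Set where
    nil  : ∀ {u} → Walk u u
    cons : ∀ {u w v} → adj G u w ≡ true → Walk w v → Walk u v

  Connected : Set
  Connected = ∀ u v → Walk u v

  Chain : List (Fin n) → Set
  Chain (x ∷ y ∷ r) = (adj G x y ≡ true) × Chain (y ∷ r)
  Chain _           = ⊤

  HasCycle : Set
  HasCycle = Σ (Fin n) λ x → Σ (List (Fin n)) λ ys →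
               (2 ≤ length ys) × Unique (x ∷ ys) × Chain (x ∷ ys ++ [ x ])

  IsTree : Set
  IsTree = (1 ≤ n) × Connected × ¬ HasCycle

  within : ℕ → Fin n → Fin n → Bool
  within zero    u w = ⌊ u ≟ w ⌋
  within (suc k) u w = within k u w ∨ anyL (allFin n)
    where
      anyL : List (Fin n) → Bool
      anyL []       = false
      anyL (x ∷ xs) = (adj G u x ∧ within k x w) ∨ anyL xs

  -- shortest-path distance: least k < n with a walk of length ≤ k
  -- (in a connected graph on n vertices every distance is < n);
  -- returns n if w is unreachable from u.
  dist : Fin n → Fin n → ℕ
  dist u w = go 0 n
    where
      go : ℕ → ℕ → ℕ
      go k zero    = k
      go k (suc f) = if within k u w then k else go (suc k) f

  closer : Fin n → Fin n → ℕ
  closer u v = sum (map (λ w → if dist w u <ᵇ dist w v then 1 else 0) (allFin n))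

  Mostar : ℕ
  Mostar = sum (concatMap (λ u → concatMap (λ v →
             if (toℕ u <ᵇ toℕ v) ∧ adj G u v
               then [ ∣ closer u v - closer v u ∣ ] else []) (allFin n)) (allFin n))

-- Let T(L, j) be the path 0 — 1 — … — L with one extra leaf attached at
-- vertex j.  Its edge t(t+1) contributes |(t + 1 + [j ≤ t]) − (L − t + [t < j])|
-- and the leaf edge contributes L.  Moving the leaf from j to j + 1 changes only
-- the contribution of the edge j(j+1), raising it by 2 as long as 2j + 2 ≤ L, so
-- Mo(T(L, j)) = Q(L) + L + 2j for 2j ≤ L, where Q(L) = Σ_{t<L} |t + 2 − (L − t)|.
-- For fixed L these values fill the even interval [Q(L) + L, Q(L) + L + 2⌊L/2⌋],
-- and since Q(L + 1) + L + 1 = Q(L) + L + 2⌊L/2⌋ + 2 the intervals for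
-- L = 0, 1, 2, … tile the even numbers.
module Submission where

open import Defs renaming (sym to adj-sym)
open import Data.Nat using (ℕ; _*_; zero; suc; _+_; _∸_; _≤_; _<_; z≤n; s≤s; _<ᵇ_; _≤ᵇ_; _≡ᵇ_; ∣_-_∣; pred; _≤?_)
open import Data.Nat.Properties
open import Algebra.Properties.CommutativeSemigroup +-commutativeSemigroup using (xy∙z≈xz∙y)
open import Data.Nat.Solver using (module +-*-Solver)
open +-*-Solver using (solve; _:+_; con; _:=_)
open import Data.Bool using (Bool; true; false; _∨_; _∧_; if_then_else_)
open import Data.Fin as Fin using (Fin; toℕ; fromℕ<)
open import Data.Fin.Properties using (toℕ-injective; toℕ<n; toℕ-fromℕ<) renaming (_≟_ to _≟ᶠ_)
open import Data.List using (List; []; _∷_; _++_; [_]; map; allFin; concatMap; tabulate)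
open import Data.List.Properties using (map-tabulate)
open import Data.Nat.ListAction using (sum)
open import Data.Nat.ListAction.Properties using (sum-++)
open import Data.List.Membership.Propositional using (_∈_)
open import Data.List.Membership.Propositional.Properties using (∈-allFin)
open import Data.List.Relation.Unary.Any using (here; there)
open import Data.List.Relation.Unary.All as All using (All; _∷_)
open import Data.List.Relation.Unary.AllPairs using (_∷_)
open import Data.List.Relation.Unary.Unique.Propositional using (Unique)
open import Data.Product using (Σ; _×_; _,_; proj₁; proj₂)
open import Data.Sum using (inj₁; inj₂)
open import Data.Empty using (⊥; ⊥-elim)
open import Data.Unit using (⊤; tt)
open import Relation.Nullary using (¬_; yes; no)
open import Relation.Binary.Definitions using (tri<; tri≈; tri>)
open import Relation.Binary.PropositionalEquality
  using (_≡_; _≢_; refl; sym; trans; cong; cong₂; subst; module ≡-Reasoning)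

-- The loops `go` of dist and `anyL` of within are local to where-blocks in
-- Defs, hence not in scope; these metavariables are solved by unification
-- with them, the `with` abstractions turning the literal arguments into variables.
mutual
  distLoop : (n : ℕ) → Graph n → Fin n → Fin n → ℕ → ℕ → ℕ
  distLoop = _

  dist-unfold : ∀ m (G : Graph (suc m)) u w →
    dist G u w ≡ (if within G 0 u w then 0 else distLoop (suc m) G u w 1 m)
  dist-unfold m G u w with suc m | 1
  ... | _ | _ = refl

mutual
  anyStep : (n : ℕ) → Graph n → ℕ → Fin n → Fin n → List (Fin n) → Bool
  anyStep = _

  within-suc : ∀ {n} (G : Graph n) k u w →
    within G (suc k) u w ≡ (within G k u w ∨ anyStep n G k u w (allFin n))
  within-suc {n} G k u w with allFin n
  ... | _ = refl

𝟙 : Bool → ℕ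
𝟙 b = if b then 1 else 0

<ᵇ-true : ∀ {a b} → a < b → (a <ᵇ b) ≡ true
<ᵇ-true {zero}  {suc b} _       = refl
<ᵇ-true {suc a} {suc b} (s≤s p) = <ᵇ-true {a} {b} p

<ᵇ-false : ∀ {a b} → b ≤ a → (a <ᵇ b) ≡ false
<ᵇ-false {a}     {zero}  _       = refl
<ᵇ-false {suc a} {suc b} (s≤s p) = <ᵇ-false {a} {b} p

<ᵇ-true⇒< : ∀ {a b} → (a <ᵇ b) ≡ true → a < b
<ᵇ-true⇒< {zero}  {suc b} _ = s≤s z≤n
<ᵇ-true⇒< {suc a} {suc b} e = s≤s (<ᵇ-true⇒< {a} {b} e)

≤ᵇ-true : ∀ {a b} → a ≤ b → (a ≤ᵇ b) ≡ true
≤ᵇ-true {zero}  _ = refl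
≤ᵇ-true {suc a} p = <ᵇ-true p

≤ᵇ-false : ∀ {a b} → b < a → (a ≤ᵇ b) ≡ false
≤ᵇ-false {suc a} (s≤s p) = <ᵇ-false p

<ᵇ-suc : ∀ a t → (a <ᵇ suc t) ≡ (a ≤ᵇ t)
<ᵇ-suc zero    t = refl
<ᵇ-suc (suc a) t = refl

≡ᵇ-refl : ∀ a → (a ≡ᵇ a) ≡ true
≡ᵇ-refl zero    = refl
≡ᵇ-refl (suc a) = ≡ᵇ-refl a

≡ᵇ-false : ∀ {a b} → a ≢ b → (a ≡ᵇ b) ≡ false
≡ᵇ-false {zero}  {zero}  a≢b = ⊥-elim (a≢b refl)
≡ᵇ-false {zero}  {suc b} _   = refl
≡ᵇ-false {suc a} {zero}  _   = refl
≡ᵇ-false {suc a} {suc b} a≢b = ≡ᵇ-false (λ e → a≢b (cong suc e))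

≡ᵇ-true⇒≡ : ∀ {a b} → (a ≡ᵇ b) ≡ true → a ≡ b
≡ᵇ-true⇒≡ {zero}  {zero}  _ = refl
≡ᵇ-true⇒≡ {suc a} {suc b} e = cong suc (≡ᵇ-true⇒≡ e)

∧-true-left : ∀ {a b} → (a ∧ b) ≡ true → a ≡ true
∧-true-left {true} _ = refl

∧-true-right : ∀ {a b} → (a ∧ b) ≡ true → b ≡ true
∧-true-right {true} e = e

true-equiv⇒≡ : ∀ {a b : Bool} → (a ≡ true → b ≡ true) → (b ≡ true → a ≡ true) → a ≡ b
true-equiv⇒≡ {true}  {true}  _ _ = refl
true-equiv⇒≡ {true}  {false} f _ = sym (f refl)
true-equiv⇒≡ {false} {true}  _ g = g refl
true-equiv⇒≡ {false} {false} _ _ = refl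

<ᵇ-+ʳ : ∀ a b y → (a + y <ᵇ b + y) ≡ (a <ᵇ b)
<ᵇ-+ʳ a b y = trans (cong₂ _<ᵇ_ (+-comm a y) (+-comm b y)) (<ᵇ-+ˡ y)
  where
  <ᵇ-+ˡ : ∀ y → (y + a <ᵇ y + b) ≡ (a <ᵇ b)
  <ᵇ-+ˡ zero    = refl
  <ᵇ-+ˡ (suc y) = <ᵇ-+ˡ y

∑ : ℕ → (ℕ → ℕ) → ℕ
∑ zero    F = 0
∑ (suc n) F = F 0 + ∑ n (λ i → F (suc i))

∑-cong : ∀ n {F G : ℕ → ℕ} → (∀ i → i < n → F i ≡ G i) → ∑ n F ≡ ∑ n G
∑-cong zero    h = refl
∑-cong (suc n) h = cong₂ _+_ (h 0 (s≤s z≤n)) (∑-cong n (λ i i<n → h (suc i) (s≤s i<n)))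

∑-const : ∀ n c → ∑ n (λ _ → c) ≡ n * c
∑-const zero    c = refl
∑-const (suc n) c = cong (c +_) (∑-const n c)

∑-zero : ∀ n → ∑ n (λ _ → 0) ≡ 0
∑-zero n = trans (∑-const n 0) (*-zeroʳ n)

∑-one : ∀ n → ∑ n (λ _ → 1) ≡ n
∑-one n = trans (∑-const n 1) (*-identityʳ n)

∑-snoc : ∀ n F → ∑ (suc n) F ≡ ∑ n F + F n
∑-snoc zero    F = +-comm (F 0) 0
∑-snoc (suc n) F = trans (cong (F 0 +_) (∑-snoc n (λ i → F (suc i))))
                         (sym (+-assoc (F 0) _ _))

∑-+ : ∀ n F G → ∑ n (λ i → F i + G i) ≡ ∑ n F + ∑ n G
∑-+ zero    F G = refl
∑-+ (suc n) F G = trans (cong (F 0 + G 0 +_) (∑-+ n (λ i → F (suc i)) (λ i → G (suc i))))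
                        (+-+-comm (F 0) (G 0) _ _)
  where
  +-+-comm : ∀ a b c d → a + b + (c + d) ≡ a + c + (b + d)
  +-+-comm = solve 4 (λ a b c d → a :+ b :+ (c :+ d) := a :+ c :+ (b :+ d)) refl

∑-comm : ∀ n m (H : ℕ → ℕ → ℕ) → ∑ n (λ a → ∑ m (H a)) ≡ ∑ m (λ b → ∑ n (λ a → H a b))
∑-comm zero    m H = sym (∑-zero m)
∑-comm (suc n) m H = trans (cong (∑ m (H 0) +_) (∑-comm n m (λ a → H (suc a))))
                           (sym (∑-+ m (H 0) _))

∑-indicator : ∀ n p c → p < n → ∑ n (λ i → if i ≡ᵇ p then c else 0) ≡ c
∑-indicator (suc n) zero    c _         = trans (cong (c +_) (∑-zero n)) (+-identityʳ c)
∑-indicator (suc n) (suc p) c (s≤s p<n) = ∑-indicator n p c p<n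

∑-update : ∀ n F G p c → p < n → (∀ i → i < n → i ≢ p → F i ≡ G i) →
  F p ≡ G p + c → ∑ n F ≡ ∑ n G + c
∑-update (suc n) F G zero c _ same at-p = begin
    F 0 + ∑ n (λ i → F (suc i))
  ≡⟨ cong₂ _+_ at-p (∑-cong n (λ i i<n → same (suc i) (s≤s i<n) (λ ()))) ⟩
    G 0 + c + ∑ n (λ i → G (suc i))
  ≡⟨ solve 3 (λ g c s → g :+ c :+ s := g :+ s :+ c) refl (G 0) c _ ⟩
    G 0 + ∑ n (λ i → G (suc i)) + c ∎
  where open ≡-Reasoning
∑-update (suc n) F G (suc p) c (s≤s p<n) same at-p =
  trans (cong₂ _+_ (same 0 (s≤s z≤n) (λ ()))
                   (∑-update n (λ i → F (suc i)) (λ i → G (suc i)) p c p<n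
                      (λ i i<n i≢p → same (suc i) (s≤s i<n) (λ e → i≢p (suc-injective e))) at-p))
        (sym (+-assoc (G 0) _ c))

∑-≤ᵇ : ∀ n t → t < n → ∑ n (λ w → 𝟙 (w ≤ᵇ t)) ≡ suc t
∑-≤ᵇ (suc n) zero    _         = cong suc (∑-zero n)
∑-≤ᵇ (suc n) (suc t) (s≤s t<n) =
  cong suc (trans (∑-cong n (λ i _ → cong 𝟙 (<ᵇ-suc i t))) (∑-≤ᵇ n t t<n))

∑-<ᵇ : ∀ n t → t < n → ∑ n (λ w → 𝟙 (t <ᵇ w)) ≡ n ∸ suc t
∑-<ᵇ (suc n) zero    _         = ∑-one n
∑-<ᵇ (suc n) (suc t) (s≤s t<n) = ∑-<ᵇ n t t<n

sum-map-allFin : ∀ n (g : Fin n → ℕ) (G : ℕ → ℕ) → (∀ i → g i ≡ G (toℕ i)) →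
  sum (map g (allFin n)) ≡ ∑ n G
sum-map-allFin n g G g≗G = trans (cong sum (map-tabulate (λ i → i) g)) (sum-tabulate n g G g≗G)
  where
  sum-tabulate : ∀ n (g : Fin n → ℕ) (G : ℕ → ℕ) → (∀ i → g i ≡ G (toℕ i)) →
    sum (tabulate g) ≡ ∑ n G
  sum-tabulate zero    g G g≗G = refl
  sum-tabulate (suc n) g G g≗G =
    cong₂ _+_ (g≗G Fin.zero) (sum-tabulate n (λ i → g (Fin.suc i)) (λ i → G (suc i)) (λ i → g≗G (Fin.suc i)))

sum-concatMap : ∀ {A : Set} (f : A → List ℕ) xs → sum (concatMap f xs) ≡ sum (map (λ x → sum (f x)) xs)
sum-concatMap f []       = refl
sum-concatMap f (x ∷ xs) = trans (sum-++ (f x) (concatMap f xs)) (cong (sum (f x) +_) (sum-concatMap f xs))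

sum-if-singleton : ∀ (b : Bool) x → sum (if b then [ x ] else []) ≡ (if b then x else 0)
sum-if-singleton true  x = +-identityʳ x
sum-if-singleton false x = refl

record IsPathMetric {n : ℕ} (G : Graph n) (δ : Fin n → Fin n → ℕ) : Set where
  field
    δ-refl   : ∀ u → δ u u ≡ 0
    δ≡0⇒≡    : ∀ u w → δ u w ≡ 0 → u ≡ w
    δ-adj    : ∀ u x w → adj G u x ≡ true → δ u w ≤ suc (δ x w)
    δ-step   : ∀ u w k → δ u w ≡ suc k → Σ (Fin n) λ x → (adj G u x ≡ true) × (δ x w ≡ k)
    δ<n      : ∀ u w → δ u w < n

module PathMetric {m : ℕ} {G : Graph (suc m)} {δ : Fin (suc m) → Fin (suc m) → ℕ}
                  (isPathMetric : IsPathMetric G δ) where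
  open IsPathMetric isPathMetric

  anyStep-true : ∀ k u w xs x → x ∈ xs → (adj G u x ∧ within G k x w) ≡ true →
    anyStep (suc m) G k u w xs ≡ true
  anyStep-true k u w (y ∷ ys) .y (here refl) e rewrite e = refl
  anyStep-true k u w (y ∷ ys) x (there x∈ys) e
    rewrite anyStep-true k u w ys x x∈ys e with adj G u y ∧ within G k y w
  ... | true  = refl
  ... | false = refl

  anyStep-false : ∀ k u w xs → (∀ x → (adj G u x ∧ within G k x w) ≡ false) →
    anyStep (suc m) G k u w xs ≡ false
  anyStep-false k u w []       h = refl
  anyStep-false k u w (y ∷ ys) h rewrite h y = anyStep-false k u w ys h

  within≡δ≤ᵇ : ∀ k u w → within G k u w ≡ (δ u w ≤ᵇ k)
  within≡δ≤ᵇ zero u w with u ≟ᶠ w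
  ... | yes refl rewrite δ-refl u = refl
  ... | no u≢w with δ u w in eq
  ...   | zero  = ⊥-elim (u≢w (δ≡0⇒≡ u w eq))
  ...   | suc _ = refl
  within≡δ≤ᵇ (suc k) u w rewrite within-suc G k u w | within≡δ≤ᵇ k u w with <-cmp (δ u w) (suc k)
  ... | tri< δ<1+k _ _
    rewrite ≤ᵇ-true {δ u w} {k} (≤-pred δ<1+k) | ≤ᵇ-true {δ u w} {suc k} (<⇒≤ δ<1+k) = refl
  ... | tri≈ _ δ≡1+k _
    rewrite ≤ᵇ-false {δ u w} {k} (subst (k <_) (sym δ≡1+k) ≤-refl)
          | ≤ᵇ-true {δ u w} {suc k} (≤-reflexive δ≡1+k) =
    let (x , u~x , δxw≡k) = δ-step u w k δ≡1+k in
    anyStep-true k u w (allFin (suc m)) x (∈-allFin x)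
      (trans (cong (_∧ within G k x w) u~x)
             (trans (within≡δ≤ᵇ k x w) (trans (cong (_≤ᵇ k) δxw≡k) (≤ᵇ-true (≤-refl {k})))))
  ... | tri> _ _ 1+k<δ
    rewrite ≤ᵇ-false {δ u w} {k} (<-trans ≤-refl 1+k<δ) | ≤ᵇ-false {δ u w} {suc k} 1+k<δ =
    anyStep-false k u w (allFin (suc m)) no-step
    where
    no-step : ∀ x → (adj G u x ∧ within G k x w) ≡ false
    no-step x with adj G u x in u~x
    ... | false = refl
    ... | true rewrite within≡δ≤ᵇ k x w = ≤ᵇ-false {δ x w} {k} (≤-pred (≤-trans 1+k<δ (δ-adj u x w u~x)))

  distLoop≡δ : ∀ u w k f → k ≤ δ u w → δ u w < k + f → distLoop (suc m) G u w k f ≡ δ u w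
  distLoop≡δ u w k zero k≤δ δ<k+0 =
    ⊥-elim (<-irrefl refl (≤-trans δ<k+0 (subst (_≤ δ u w) (sym (+-identityʳ k)) k≤δ)))
  distLoop≡δ u w k (suc f) k≤δ δ<k+f rewrite within≡δ≤ᵇ k u w with m≤n⇒m<n∨m≡n k≤δ
  ... | inj₂ refl rewrite ≤ᵇ-true (≤-refl {k}) = refl
  ... | inj₁ k<δ  rewrite ≤ᵇ-false {δ u w} {k} k<δ =
    distLoop≡δ u w (suc k) f k<δ (subst (δ u w <_) (+-suc k f) δ<k+f)

  dist≡δ : ∀ u w → dist G u w ≡ δ u w
  dist≡δ u w = trans (dist-unfold m G u w) (distLoop≡δ u w 0 (suc m) z≤n (δ<n u w))

  connected : Connected G
  connected u w = walk-of-length (δ u w) u w refl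
    where
    walk-of-length : ∀ d u w → δ u w ≡ d → Walk G u w
    walk-of-length zero    u w δ≡0 rewrite δ≡0⇒≡ u w δ≡0 = nil
    walk-of-length (suc d) u w δ≡1+d with δ-step u w d δ≡1+d
    ... | x , u~x , δxw≡d = cons u~x (walk-of-length d x w δxw≡d)

-- A graph in which every vertex has at most one neighbour of smaller index is
-- acyclic: walking along a cycle without backtracking, the first ascending step
-- forces all later steps to ascend, and dually for descending steps, so the
-- cycle can neither return to its start nor meet a vertex with two lower neighbours.
module LowerNeighbour {n : ℕ} (G : Graph n)
  (lower-unique : ∀ a b c → adj G a b ≡ true → adj G a c ≡ true →
                  toℕ b < toℕ a → toℕ c < toℕ a → b ≡ c)
  where

  NoBacktrack : List (Fin n) → Set
  NoBacktrack (x ∷ y ∷ z ∷ r) = (x ≢ z) × NoBacktrack (y ∷ z ∷ r)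
  NoBacktrack _               = ⊤

  last : Fin n → List (Fin n) → Fin n
  last x []       = x
  last x (y ∷ ys) = last y ys

  LastStepDescends : List (Fin n) → Set
  LastStepDescends (a ∷ b ∷ [])    = toℕ b < toℕ a
  LastStepDescends (a ∷ b ∷ c ∷ r) = LastStepDescends (b ∷ c ∷ r)
  LastStepDescends _               = ⊥

  adj⇒toℕ≢ : ∀ {a b} → adj G a b ≡ true → toℕ a ≢ toℕ b
  adj⇒toℕ≢ {a} a~b eq with toℕ-injective eq
  ... | refl with trans (sym a~b) (irrefl G a)
  ... | ()

  ascending : ∀ a b r → Chain G (a ∷ b ∷ r) → NoBacktrack (a ∷ b ∷ r) → toℕ a < toℕ b →
    (toℕ a < toℕ (last b r)) × ¬ LastStepDescends (a ∷ b ∷ r)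
  ascending a b []      _              _          a<b = a<b , <-asym a<b
  ascending a b (c ∷ r) (a~b , b~c∷ch) (a≢c , nb) a<b with <-cmp (toℕ b) (toℕ c)
  ... | tri< b<c _ _ = let (b<last , ¬desc) = ascending b c r b~c∷ch nb b<c in <-trans a<b b<last , ¬desc
  ... | tri≈ _ b≡c _ = ⊥-elim (adj⇒toℕ≢ (proj₁ b~c∷ch) b≡c)
  ... | tri> _ _ c<b = ⊥-elim (a≢c (lower-unique b a c (trans (adj-sym G b a) a~b) (proj₁ b~c∷ch) a<b c<b))

  descending : ∀ a b r → Chain G (a ∷ b ∷ r) → NoBacktrack (a ∷ b ∷ r) →
    LastStepDescends (a ∷ b ∷ r) → toℕ (last b r) < toℕ a
  descending a b r ch nb desc with <-cmp (toℕ a) (toℕ b)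
  ... | tri< a<b _ _ = ⊥-elim (proj₂ (ascending a b r ch nb a<b) desc)
  ... | tri≈ _ a≡b _ = ⊥-elim (adj⇒toℕ≢ (proj₁ ch) a≡b)
  descending a b []      ch nb desc | tri> _ _ b<a = b<a
  descending a b (c ∷ r) ch nb desc | tri> _ _ b<a = <-trans (descending b c r (proj₂ ch) (proj₂ nb) desc) b<a

  last-++ : ∀ b l x → last b (l ++ [ x ]) ≡ x
  last-++ b []      x = refl
  last-++ b (c ∷ l) x = last-++ c l x

  last-∈ : ∀ b l → last b l ∈ b ∷ l
  last-∈ b []      = here refl
  last-∈ b (c ∷ l) = there (last-∈ c l)

  lastStepDescends-++ : ∀ a b l x → toℕ x < toℕ (last b l) → LastStepDescends (a ∷ b ∷ l ++ [ x ])
  lastStepDescends-++ a b []      x x<last = x<last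
  lastStepDescends-++ a b (c ∷ l) x x<last = lastStepDescends-++ b c l x x<last

  chain-last : ∀ b l x → Chain G (b ∷ l ++ [ x ]) → adj G (last b l) x ≡ true
  chain-last b []      x ch = proj₁ ch
  chain-last b (c ∷ l) x ch = chain-last c l x (proj₂ ch)

  noBacktrack-++ : ∀ l x → Unique l → All (x ≢_) l → NoBacktrack (l ++ [ x ])
  noBacktrack-++ []              x _                   _              = tt
  noBacktrack-++ (a ∷ [])        x _                   _              = tt
  noBacktrack-++ (a ∷ b ∷ [])    x _                   (x≢a ∷ _)      = (λ a≡x → x≢a (sym a≡x)) , tt
  noBacktrack-++ (a ∷ b ∷ c ∷ r) x ((_ ∷ a≢c ∷ _) ∷ u) (_ ∷ x∉b∷c∷r) = a≢c , noBacktrack-++ (b ∷ c ∷ r) x u x∉b∷c∷r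

  acyclic : ¬ HasCycle G
  acyclic (x , []          , () , _)
  acyclic (x , _ ∷ []      , s≤s () , _)
  acyclic (x , y₁ ∷ y₂ ∷ ys , _ , (x∉ys ∷ y₁∉ys ∷ uniq) , ch) = closed-walk-absurd
    where
    l : List (Fin n)
    l = y₂ ∷ ys
    nb : NoBacktrack (x ∷ y₁ ∷ l ++ [ x ])
    nb = All.lookup x∉ys (there (here refl)) , noBacktrack-++ (y₁ ∷ l) x (y₁∉ys ∷ uniq) x∉ys

    closed-walk-absurd : ⊥
    closed-walk-absurd with <-cmp (toℕ x) (toℕ y₁)
    ... | tri< x<y₁ _ _ =
      <-irrefl (cong toℕ (sym (last-++ y₁ l x))) (proj₁ (ascending x y₁ (l ++ [ x ]) ch nb x<y₁))
    ... | tri≈ _ x≡y₁ _ = adj⇒toℕ≢ (proj₁ ch) x≡y₁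
    ... | tri> _ _ y₁<x with <-cmp (toℕ x) (toℕ (last y₁ l))
    ...   | tri< x<yₖ _ _ =
      <-irrefl (cong toℕ (last-++ y₁ l x)) (descending x y₁ (l ++ [ x ]) ch nb (lastStepDescends-++ x y₁ l x x<yₖ))
    ...   | tri≈ _ x≡yₖ _ = adj⇒toℕ≢ (chain-last y₁ l x (proj₂ ch)) (sym x≡yₖ)
    ...   | tri> _ _ yₖ<x = All.lookup y₁∉ys (last-∈ y₂ ys)
      (lower-unique x y₁ (last y₁ l) (proj₁ ch) (trans (adj-sym G x _) (chain-last y₁ l x (proj₂ ch))) y₁<x yₖ<x)

∣n-1+n∣≡1 : ∀ a → ∣ a - suc a ∣ ≡ 1
∣n-1+n∣≡1 zero    = refl
∣n-1+n∣≡1 (suc a) = ∣n-1+n∣≡1 a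

∣1+n-n∣≡1 : ∀ a → ∣ suc a - a ∣ ≡ 1
∣1+n-n∣≡1 a = trans (∣-∣-comm (suc a) a) (∣n-1+n∣≡1 a)

∣-∣-step-up : ∀ a x k → a < x → ∣ a - x ∣ ≡ suc k → ∣ suc a - x ∣ ≡ k
∣-∣-step-up zero    (suc x) k _         e = suc-injective e
∣-∣-step-up (suc a) (suc x) k (s≤s a<x) e = ∣-∣-step-up a x k a<x e

∣-∣-step-down : ∀ a x k → x ≤ a → ∣ suc a - x ∣ ≡ suc k → ∣ a - x ∣ ≡ k
∣-∣-step-down a       zero    k _         e = trans (∣-∣-identityʳ a) (suc-injective e)
∣-∣-step-down (suc a) (suc x) k (s≤s x≤a) e = ∣-∣-step-down a x k x≤a e

∣-∣≡1⇒≡suc : ∀ a b → a < b → ∣ a - b ∣ ≡ 1 → b ≡ suc a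
∣-∣≡1⇒≡suc zero    (suc b) _         e = e
∣-∣≡1⇒≡suc (suc a) (suc b) (s≤s a<b) e = cong suc (∣-∣≡1⇒≡suc a b a<b e)

∣-∣≤ : ∀ x y c → x ≤ c → y ≤ c → ∣ x - y ∣ ≤ c
∣-∣≤ x y c x≤c y≤c = ≤-trans (∣m-n∣≤m⊔n x y) (⊔-lub x≤c y≤c)

∣n-m∣<ᵇ∣n-1+m∣ : ∀ x t → (∣ x - t ∣ <ᵇ ∣ x - suc t ∣) ≡ (x ≤ᵇ t)
∣n-m∣<ᵇ∣n-1+m∣ zero    t       = <ᵇ-true (n<1+n t)
∣n-m∣<ᵇ∣n-1+m∣ (suc x) zero    = trans (cong (suc x <ᵇ_) (∣-∣-identityʳ x)) (<ᵇ-false (n≤1+n x))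
∣n-m∣<ᵇ∣n-1+m∣ (suc x) (suc t) = trans (∣n-m∣<ᵇ∣n-1+m∣ x t) (sym (<ᵇ-suc x t))

∣n-1+m∣<ᵇ∣n-m∣ : ∀ x t → (∣ x - suc t ∣ <ᵇ ∣ x - t ∣) ≡ (t <ᵇ x)
∣n-1+m∣<ᵇ∣n-m∣ zero    t       = <ᵇ-false (n≤1+n t)
∣n-1+m∣<ᵇ∣n-m∣ (suc x) zero    = trans (cong (_<ᵇ suc x) (∣-∣-identityʳ x)) (<ᵇ-true (n<1+n x))
∣n-1+m∣<ᵇ∣n-m∣ (suc x) (suc t) = ∣n-1+m∣<ᵇ∣n-m∣ x t

imbalance : ℕ → ℕ → ℕ → ℕ
imbalance L j t = ∣ (suc t + 𝟙 (j ≤ᵇ t)) - ((L ∸ t) + 𝟙 (t <ᵇ j)) ∣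

-- The path 0 — 1 — … — L with a pendant vertex L+1 attached at j.  Its path
-- metric is the ℓ¹-distance of the plane embedding w ↦ (w, 0), L+1 ↦ (j, 1).
module PathWithPendant (L j : ℕ) (j≤L : j ≤ L) where

  N : ℕ
  N = suc (suc L)

  isPendant : ℕ → Bool
  isPendant w = w ≡ᵇ suc L

  X Y : ℕ → ℕ
  X w = if isPendant w then j else w
  Y w = if isPendant w then 1 else 0

  d : ℕ → ℕ → ℕ
  d a b = ∣ X a - X b ∣ + ∣ Y a - Y b ∣

  onPath⇒¬pendant : ∀ w → w ≤ L → isPendant w ≡ false
  onPath⇒¬pendant w w≤L = ≡ᵇ-false (λ w≡1+L → 1+n≰n (subst (_≤ L) w≡1+L w≤L))

  X-onPath : ∀ w → w ≤ L → X w ≡ w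
  X-onPath w w≤L = cong (λ b → if b then j else w) (onPath⇒¬pendant w w≤L)

  Y-onPath : ∀ w → w ≤ L → Y w ≡ 0
  Y-onPath w w≤L = cong (λ b → if b then 1 else 0) (onPath⇒¬pendant w w≤L)

  X-pendant : X (suc L) ≡ j
  X-pendant = cong (λ b → if b then j else suc L) (≡ᵇ-refl (suc L))

  Y-pendant : Y (suc L) ≡ 1
  Y-pendant = cong (λ b → if b then 1 else 0) (≡ᵇ-refl (suc L))

  data Position : ℕ → Set where
    onPath  : ∀ {w} → w ≤ L → Position w
    pendant : Position (suc L)

  position : ∀ w → w < N → Position w
  position w (s≤s w≤1+L) with m≤n⇒m<n∨m≡n w≤1+L
  ... | inj₁ w<1+L = onPath (≤-pred w<1+L)
  ... | inj₂ refl  = pendant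

  d-onPath : ∀ {a b} → a ≤ L → b ≤ L → d a b ≡ ∣ a - b ∣
  d-onPath {a} {b} a≤L b≤L =
    trans (cong₂ _+_ (cong₂ ∣_-_∣ (X-onPath a a≤L) (X-onPath b b≤L)) (cong₂ ∣_-_∣ (Y-onPath a a≤L) (Y-onPath b b≤L)))
          (+-identityʳ _)

  d-to-pendant : ∀ {a} → a ≤ L → d a (suc L) ≡ suc ∣ a - j ∣
  d-to-pendant {a} a≤L =
    trans (cong₂ _+_ (cong₂ ∣_-_∣ (X-onPath a a≤L) X-pendant) (cong₂ ∣_-_∣ (Y-onPath a a≤L) Y-pendant)) (+-comm _ 1)

  d-from-pendant : ∀ {b} → b ≤ L → d (suc L) b ≡ suc ∣ j - b ∣
  d-from-pendant {b} b≤L =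
    trans (cong₂ _+_ (cong₂ ∣_-_∣ X-pendant (X-onPath b b≤L)) (cong₂ ∣_-_∣ Y-pendant (Y-onPath b b≤L))) (+-comm _ 1)

  d-refl : ∀ a → d a a ≡ 0
  d-refl a = cong₂ _+_ (∣n-n∣≡0 (X a)) (∣n-n∣≡0 (Y a))

  d-sym : ∀ a b → d a b ≡ d b a
  d-sym a b = cong₂ _+_ (∣-∣-comm (X a) (X b)) (∣-∣-comm (Y a) (Y b))

  d-triangle : ∀ a b c → d a c ≤ d a b + d b c
  d-triangle a b c = ≤-trans (+-mono-≤ (∣-∣-triangle (X a) (X b) (X c)) (∣-∣-triangle (Y a) (Y b) (Y c)))
    (≤-reflexive (solve 4 (λ p q r s → p :+ r :+ (q :+ s) := p :+ q :+ (r :+ s)) refl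
                          ∣ X a - X b ∣ ∣ Y a - Y b ∣ ∣ X b - X c ∣ ∣ Y b - Y c ∣))

  d≡0⇒≡ : ∀ a b → a < N → b < N → d a b ≡ 0 → a ≡ b
  d≡0⇒≡ a b a<N b<N d≡0 with position a a<N | position b b<N
  ... | onPath a≤L | onPath b≤L = ∣m-n∣≡0⇒m≡n (trans (sym (d-onPath a≤L b≤L)) d≡0)
  ... | onPath a≤L | pendant    = ⊥-elim (1+n≢0 (trans (sym (d-to-pendant a≤L)) d≡0))
  ... | pendant    | onPath b≤L = ⊥-elim (1+n≢0 (trans (sym (d-from-pendant b≤L)) d≡0))
  ... | pendant    | pendant    = refl

  d<N : ∀ a b → a < N → b < N → d a b < N
  d<N a b a<N b<N = s≤s (≤-trans (+-mono-≤ (∣-∣≤ (X a) (X b) L (X≤L a a<N) (X≤L b b<N))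
                                           (∣-∣≤ (Y a) (Y b) 1 (Y≤1 a) (Y≤1 b)))
                                 (≤-reflexive (+-comm L 1)))
    where
    X≤L : ∀ w → w < N → X w ≤ L
    X≤L w w<N with position w w<N
    ... | onPath w≤L = subst (_≤ L) (sym (X-onPath w w≤L)) w≤L
    ... | pendant    = subst (_≤ L) (sym X-pendant) j≤L
    Y≤1 : ∀ w → Y w ≤ 1
    Y≤1 w with isPendant w
    ... | true  = ≤-refl
    ... | false = z≤n

  path-step : ∀ a x k → a ≤ L → x ≤ L → ∣ a - x ∣ ≡ suc k →
    Σ ℕ λ c → (c ≤ L) × (∣ a - c ∣ ≡ 1) × (∣ c - x ∣ ≡ k)
  path-step a x k a≤L x≤L e with <-cmp a x
  ... | tri< a<x _ _ = suc a , ≤-trans a<x x≤L , ∣n-1+n∣≡1 a , ∣-∣-step-up a x k a<x e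
  ... | tri≈ _ refl _ = ⊥-elim (1+n≢0 (trans (sym e) (∣n-n∣≡0 a)))
  path-step (suc a) x k a≤L x≤L e | tri> _ _ x<1+a =
    a , ≤-trans (n≤1+n a) a≤L , ∣1+n-n∣≡1 a , ∣-∣-step-down a x k (≤-pred x<1+a) e

  d-step : ∀ a b k → a < N → b < N → d a b ≡ suc k →
    Σ ℕ λ c → (c < N) × (d a c ≡ 1) × (d c b ≡ k)
  d-step a b k a<N b<N e with position a a<N | position b b<N
  ... | onPath a≤L | onPath b≤L with path-step a b k a≤L b≤L (trans (sym (d-onPath a≤L b≤L)) e)
  ...   | c , c≤L , e₁ , e₂ = c , s≤s (≤-trans c≤L (n≤1+n L)) , trans (d-onPath a≤L c≤L) e₁ , trans (d-onPath c≤L b≤L) e₂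
  d-step a b zero a<N b<N e | onPath a≤L | pendant = suc L , ≤-refl , e , d-refl (suc L)
  d-step a b (suc k) a<N b<N e | onPath a≤L | pendant
    with path-step a j k a≤L j≤L (suc-injective (trans (sym (d-to-pendant a≤L)) e))
  ... | c , c≤L , e₁ , e₂ =
    c , s≤s (≤-trans c≤L (n≤1+n L)) , trans (d-onPath a≤L c≤L) e₁ , trans (d-to-pendant c≤L) (cong suc e₂)
  d-step a b k a<N b<N e | pendant | onPath b≤L =
    j , s≤s (≤-trans j≤L (n≤1+n L)) , trans (d-from-pendant j≤L) (cong suc (∣n-n∣≡0 j)) ,
    trans (d-onPath j≤L b≤L) (suc-injective (trans (sym (d-from-pendant b≤L)) e))
  d-step a b k a<N b<N e | pendant | pendant = ⊥-elim (1+n≢0 (trans (sym e) (d-refl (suc L))))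

  dᶠ : Fin N → Fin N → ℕ
  dᶠ u w = d (toℕ u) (toℕ w)

  T : Graph N
  T = record { adj    = λ u v → dᶠ u v ≡ᵇ 1
             ; sym    = λ u v → cong (_≡ᵇ 1) (d-sym (toℕ u) (toℕ v))
             ; irrefl = λ u → cong (_≡ᵇ 1) (d-refl (toℕ u)) }

  isPathMetric : IsPathMetric T dᶠ
  isPathMetric = record
    { δ-refl = λ u → d-refl (toℕ u)
    ; δ≡0⇒≡  = λ u w e → toℕ-injective (d≡0⇒≡ (toℕ u) (toℕ w) (toℕ<n u) (toℕ<n w) e)
    ; δ-adj  = λ u x w u~x → subst (λ z → dᶠ u w ≤ z + dᶠ x w) (≡ᵇ-true⇒≡ {dᶠ u x} {1} u~x) (d-triangle (toℕ u) (toℕ x) (toℕ w))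
    ; δ-step = step
    ; δ<n    = λ u w → d<N (toℕ u) (toℕ w) (toℕ<n u) (toℕ<n w) }
    where
    step : ∀ u w k → dᶠ u w ≡ suc k → Σ (Fin N) λ x → (adj T u x ≡ true) × (dᶠ x w ≡ k)
    step u w k e with d-step (toℕ u) (toℕ w) k (toℕ<n u) (toℕ<n w) e
    ... | c , c<N , e₁ , e₂ =
      fromℕ< c<N ,
      trans (cong (λ z → d (toℕ u) z ≡ᵇ 1) (toℕ-fromℕ< c<N)) (cong (_≡ᵇ 1) e₁) ,
      trans (cong (λ z → d z (toℕ w)) (toℕ-fromℕ< c<N)) e₂

  open PathMetric isPathMetric using (dist≡δ; connected)

  parent : ℕ → ℕ
  parent b = if isPendant b then j else pred b

  parent-onPath : ∀ b → b ≤ L → parent b ≡ pred b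
  parent-onPath b b≤L = cong (λ x → if x then j else pred b) (onPath⇒¬pendant b b≤L)

  parent-pendant : parent (suc L) ≡ j
  parent-pendant = cong (λ x → if x then j else L) (≡ᵇ-refl (suc L))

  lower-neighbour⇒parent : ∀ a b → b < N → a < b → d a b ≡ 1 → a ≡ parent b
  lower-neighbour⇒parent a b b<N a<b d≡1 with position b b<N
  ... | onPath b≤L = sym (trans (parent-onPath b b≤L)
                                (cong pred (∣-∣≡1⇒≡suc a b a<b (trans (sym (d-onPath (≤-trans (<⇒≤ a<b) b≤L) b≤L)) d≡1))))
  ... | pendant    = trans (∣m-n∣≡0⇒m≡n (suc-injective (trans (sym (d-to-pendant (≤-pred a<b))) d≡1)))
                           (sym parent-pendant)

  parent-neighbour : ∀ b → 1 ≤ b → b < N → (parent b < b) × (d (parent b) b ≡ 1)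
  parent-neighbour (suc t) _ b<N with position (suc t) b<N
  ... | onPath 1+t≤L = subst (λ p → (p < suc t) × (d p (suc t) ≡ 1)) (sym (parent-onPath (suc t) 1+t≤L))
                         (≤-refl , trans (d-onPath (≤-trans (n≤1+n t) 1+t≤L) 1+t≤L) (∣n-1+n∣≡1 t))
  ... | pendant      = subst (λ p → (p < suc L) × (d p (suc L) ≡ 1)) (sym parent-pendant)
                         (s≤s j≤L , trans (d-to-pendant j≤L) (cong suc (∣n-n∣≡0 j)))

  isTree : IsTree T
  isTree = s≤s z≤n , connected , LowerNeighbour.acyclic T lower-unique
    where
    lower-unique : ∀ a b c → adj T a b ≡ true → adj T a c ≡ true → toℕ b < toℕ a → toℕ c < toℕ a → b ≡ c
    lower-unique a b c a~b a~c b<a c<a = toℕ-injective (trans (is-parent b a~b b<a) (sym (is-parent c a~c c<a)))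
      where
      is-parent : ∀ b → adj T a b ≡ true → toℕ b < toℕ a → toℕ b ≡ parent (toℕ a)
      is-parent b a~b b<a = lower-neighbour⇒parent (toℕ b) (toℕ a) (toℕ<n a) b<a
                              (trans (d-sym (toℕ b) (toℕ a)) (≡ᵇ-true⇒≡ {dᶠ a b} {1} a~b))

  closerℕ : ℕ → ℕ → ℕ
  closerℕ a b = ∑ N (λ w → 𝟙 (d w a <ᵇ d w b))

  d-to-path : ∀ w t → t ≤ L → d w t ≡ ∣ X w - t ∣ + Y w
  d-to-path w t t≤L = cong₂ _+_ (cong (λ z → ∣ X w - z ∣) (X-onPath t t≤L))
                                (trans (cong (λ z → ∣ Y w - z ∣) (Y-onPath t t≤L)) (∣-∣-identityʳ (Y w)))

  ∑-over-X : ∀ (P : ℕ → Bool) → ∑ N (λ w → 𝟙 (P (X w))) ≡ ∑ (suc L) (λ w → 𝟙 (P w)) + 𝟙 (P j)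
  ∑-over-X P = trans (∑-snoc (suc L) (λ w → 𝟙 (P (X w))))
    (cong₂ _+_ (∑-cong (suc L) (λ w w≤L → cong (λ z → 𝟙 (P z)) (X-onPath w (≤-pred w≤L))))
               (cong (λ z → 𝟙 (P z)) X-pendant))

  closer-forward : ∀ t → t < L → closerℕ t (suc t) ≡ suc t + 𝟙 (j ≤ᵇ t)
  closer-forward t t<L = begin
      ∑ N (λ w → 𝟙 (d w t <ᵇ d w (suc t)))
    ≡⟨ ∑-cong N (λ w _ → cong 𝟙 (closer-to-t w)) ⟩
      ∑ N (λ w → 𝟙 (X w ≤ᵇ t))
    ≡⟨ ∑-over-X (_≤ᵇ t) ⟩
      ∑ (suc L) (λ w → 𝟙 (w ≤ᵇ t)) + 𝟙 (j ≤ᵇ t)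
    ≡⟨ cong (_+ 𝟙 (j ≤ᵇ t)) (∑-≤ᵇ (suc L) t (≤-trans t<L (n≤1+n L))) ⟩
      suc t + 𝟙 (j ≤ᵇ t) ∎
    where
    open ≡-Reasoning
    closer-to-t : ∀ w → (d w t <ᵇ d w (suc t)) ≡ (X w ≤ᵇ t)
    closer-to-t w = trans (cong₂ _<ᵇ_ (d-to-path w t (<⇒≤ t<L)) (d-to-path w (suc t) t<L))
                            (trans (<ᵇ-+ʳ ∣ X w - t ∣ ∣ X w - suc t ∣ (Y w)) (∣n-m∣<ᵇ∣n-1+m∣ (X w) t))

  closer-backward : ∀ t → t < L → closerℕ (suc t) t ≡ (L ∸ t) + 𝟙 (t <ᵇ j)
  closer-backward t t<L = begin
      ∑ N (λ w → 𝟙 (d w (suc t) <ᵇ d w t))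
    ≡⟨ ∑-cong N (λ w _ → cong 𝟙 (closer-to-1+t w)) ⟩
      ∑ N (λ w → 𝟙 (t <ᵇ X w))
    ≡⟨ ∑-over-X (t <ᵇ_) ⟩
      ∑ (suc L) (λ w → 𝟙 (t <ᵇ w)) + 𝟙 (t <ᵇ j)
    ≡⟨ cong (_+ 𝟙 (t <ᵇ j)) (∑-<ᵇ (suc L) t (≤-trans t<L (n≤1+n L))) ⟩
      (L ∸ t) + 𝟙 (t <ᵇ j) ∎
    where
    open ≡-Reasoning
    closer-to-1+t : ∀ w → (d w (suc t) <ᵇ d w t) ≡ (t <ᵇ X w)
    closer-to-1+t w = trans (cong₂ _<ᵇ_ (d-to-path w (suc t) t<L) (d-to-path w t (<⇒≤ t<L)))
                              (trans (<ᵇ-+ʳ ∣ X w - suc t ∣ ∣ X w - t ∣ (Y w)) (∣n-1+m∣<ᵇ∣n-m∣ (X w) t))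

  closer-attachment : closerℕ j (suc L) ≡ suc L
  closer-attachment = begin
      ∑ N (λ w → 𝟙 (d w j <ᵇ d w (suc L)))
    ≡⟨ ∑-snoc (suc L) (λ w → 𝟙 (d w j <ᵇ d w (suc L))) ⟩
      ∑ (suc L) (λ w → 𝟙 (d w j <ᵇ d w (suc L))) + 𝟙 (d (suc L) j <ᵇ d (suc L) (suc L))
    ≡⟨ cong₂ _+_ (trans (∑-cong (suc L) path-closer) (∑-one (suc L)))
                 (cong (λ z → 𝟙 (d (suc L) j <ᵇ z)) (d-refl (suc L))) ⟩
      suc L + 0
    ≡⟨ +-identityʳ (suc L) ⟩
      suc L ∎
    where
    open ≡-Reasoning
    path-closer : ∀ w → w < suc L → 𝟙 (d w j <ᵇ d w (suc L)) ≡ 1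
    path-closer w w<1+L = cong 𝟙 (trans (cong₂ _<ᵇ_ (d-onPath (≤-pred w<1+L) j≤L) (d-to-pendant (≤-pred w<1+L)))
                                        (<ᵇ-true (n<1+n ∣ w - j ∣)))

  closer-pendant : closerℕ (suc L) j ≡ 1
  closer-pendant = begin
      ∑ N (λ w → 𝟙 (d w (suc L) <ᵇ d w j))
    ≡⟨ ∑-snoc (suc L) (λ w → 𝟙 (d w (suc L) <ᵇ d w j)) ⟩
      ∑ (suc L) (λ w → 𝟙 (d w (suc L) <ᵇ d w j)) + 𝟙 (d (suc L) (suc L) <ᵇ d (suc L) j)
    ≡⟨ cong₂ _+_ (trans (∑-cong (suc L) path-farther) (∑-zero (suc L)))
                 (cong₂ (λ x y → 𝟙 (x <ᵇ y)) (d-refl (suc L)) (d-from-pendant j≤L)) ⟩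
      1 ∎
    where
    open ≡-Reasoning
    path-farther : ∀ w → w < suc L → 𝟙 (d w (suc L) <ᵇ d w j) ≡ 0
    path-farther w w<1+L = cong 𝟙 (trans (cong₂ _<ᵇ_ (d-to-pendant (≤-pred w<1+L)) (d-onPath (≤-pred w<1+L) j≤L))
                                          (<ᵇ-false (n≤1+n ∣ w - j ∣)))

  edgeImbalance : ℕ → ℕ
  edgeImbalance b = if isPendant b then L else imbalance L j (pred b)

  edgeImbalance-onPath : ∀ t → t < L → edgeImbalance (suc t) ≡ imbalance L j t
  edgeImbalance-onPath t t<L = cong (λ x → if x then L else imbalance L j t) (onPath⇒¬pendant (suc t) t<L)

  edgeImbalance-pendant : edgeImbalance (suc L) ≡ L
  edgeImbalance-pendant = cong (λ x → if x then L else imbalance L j L) (≡ᵇ-refl (suc L))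

  parent-edge-imbalance : ∀ b → 1 ≤ b → b < N →
    ∣ closerℕ (parent b) b - closerℕ b (parent b) ∣ ≡ edgeImbalance b
  parent-edge-imbalance (suc t) _ b<N with position (suc t) b<N
  ... | onPath t<L = begin
      ∣ closerℕ (parent (suc t)) (suc t) - closerℕ (suc t) (parent (suc t)) ∣
    ≡⟨ cong (λ p → ∣ closerℕ p (suc t) - closerℕ (suc t) p ∣) (parent-onPath (suc t) t<L) ⟩
      ∣ closerℕ t (suc t) - closerℕ (suc t) t ∣
    ≡⟨ cong₂ ∣_-_∣ (closer-forward t t<L) (closer-backward t t<L) ⟩
      imbalance L j t
    ≡⟨ sym (edgeImbalance-onPath t t<L) ⟩
      edgeImbalance (suc t) ∎
    where open ≡-Reasoning
  ... | pendant = begin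
      ∣ closerℕ (parent (suc L)) (suc L) - closerℕ (suc L) (parent (suc L)) ∣
    ≡⟨ cong (λ p → ∣ closerℕ p (suc L) - closerℕ (suc L) p ∣) parent-pendant ⟩
      ∣ closerℕ j (suc L) - closerℕ (suc L) j ∣
    ≡⟨ cong₂ ∣_-_∣ closer-attachment closer-pendant ⟩
      ∣ L - 0 ∣
    ≡⟨ ∣-∣-identityʳ L ⟩
      L
    ≡⟨ sym edgeImbalance-pendant ⟩
      edgeImbalance (suc L) ∎
    where open ≡-Reasoning

  isEdgeUp : ℕ → ℕ → Bool
  isEdgeUp a b = (a <ᵇ b) ∧ (d a b ≡ᵇ 1)

  isEdgeUp⇒parent : ∀ a b → b < N → isEdgeUp a b ≡ true → a ≡ parent b
  isEdgeUp⇒parent a b b<N e =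
    lower-neighbour⇒parent a b b<N (<ᵇ-true⇒< (∧-true-left e)) (≡ᵇ-true⇒≡ {d a b} {1} (∧-true-right {a <ᵇ b} e))

  isEdgeUp≡isParent : ∀ a b → 1 ≤ b → b < N → isEdgeUp a b ≡ (a ≡ᵇ parent b)
  isEdgeUp≡isParent a b 1≤b b<N = true-equiv⇒≡
    (λ e → subst (λ p → (a ≡ᵇ p) ≡ true) (isEdgeUp⇒parent a b b<N e) (≡ᵇ-refl a))
    (λ e → subst (λ p → isEdgeUp p b ≡ true) (sym (≡ᵇ-true⇒≡ {a} {parent b} e))
             (cong₂ _∧_ (<ᵇ-true (proj₁ (parent-neighbour b 1≤b b<N)))
                        (cong (_≡ᵇ 1) (proj₂ (parent-neighbour b 1≤b b<N)))))

  edgeTerm : ℕ → ℕ → ℕ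
  edgeTerm a b = if isEdgeUp a b then edgeImbalance b else 0

  closer≡closerℕ : ∀ u v → closer T u v ≡ closerℕ (toℕ u) (toℕ v)
  closer≡closerℕ u v = sum-map-allFin N _ (λ w → 𝟙 (d w (toℕ u) <ᵇ d w (toℕ v)))
    (λ w → cong₂ (λ x y → 𝟙 (x <ᵇ y)) (dist≡δ w u) (dist≡δ w v))

  mostarTerm≡edgeTerm : ∀ u v →
    (if isEdgeUp (toℕ u) (toℕ v) then ∣ closer T u v - closer T v u ∣ else 0) ≡ edgeTerm (toℕ u) (toℕ v)
  mostarTerm≡edgeTerm u v with isEdgeUp (toℕ u) (toℕ v) in e
  ... | false = refl
  ... | true  = begin
      ∣ closer T u v - closer T v u ∣
    ≡⟨ cong₂ ∣_-_∣ (closer≡closerℕ u v) (closer≡closerℕ v u) ⟩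
      ∣ closerℕ (toℕ u) (toℕ v) - closerℕ (toℕ v) (toℕ u) ∣
    ≡⟨ cong (λ p → ∣ closerℕ p (toℕ v) - closerℕ (toℕ v) p ∣) (isEdgeUp⇒parent (toℕ u) (toℕ v) (toℕ<n v) e) ⟩
      ∣ closerℕ (parent (toℕ v)) (toℕ v) - closerℕ (toℕ v) (parent (toℕ v)) ∣
    ≡⟨ parent-edge-imbalance (toℕ v) (≤-trans (s≤s z≤n) (<ᵇ-true⇒< (∧-true-left e))) (toℕ<n v) ⟩
      edgeImbalance (toℕ v) ∎
    where open ≡-Reasoning

  Mostar≡∑edgeTerm : Mostar T ≡ ∑ N (λ a → ∑ N (edgeTerm a))
  Mostar≡∑edgeTerm = trans (sum-concatMap row (allFin N))
    (sum-map-allFin N (λ u → sum (row u)) (λ a → ∑ N (edgeTerm a)) λ u →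
      trans (sum-concatMap (entry u) (allFin N))
            (sum-map-allFin N (λ v → sum (entry u v)) (edgeTerm (toℕ u)) λ v →
              trans (sum-if-singleton (isEdgeUp (toℕ u) (toℕ v)) ∣ closer T u v - closer T v u ∣)
                    (mostarTerm≡edgeTerm u v)))
    where
    entry : Fin N → Fin N → List ℕ
    entry u v = if isEdgeUp (toℕ u) (toℕ v) then [ ∣ closer T u v - closer T v u ∣ ] else []
    row : Fin N → List ℕ
    row u = concatMap (entry u) (allFin N)

  ∑edgeTerm : ∑ N (λ a → ∑ N (edgeTerm a)) ≡ ∑ L (imbalance L j) + L
  ∑edgeTerm = begin
      ∑ N (λ a → ∑ N (edgeTerm a))
    ≡⟨ ∑-comm N N edgeTerm ⟩
      ∑ N (λ b → ∑ N (λ a → edgeTerm a b))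
    ≡⟨ cong₂ _+_ (∑-zero N) (∑-cong (suc L) column) ⟩
      ∑ (suc L) (λ t → edgeImbalance (suc t))
    ≡⟨ ∑-snoc L (λ t → edgeImbalance (suc t)) ⟩
      ∑ L (λ t → edgeImbalance (suc t)) + edgeImbalance (suc L)
    ≡⟨ cong₂ _+_ (∑-cong L edgeImbalance-onPath) edgeImbalance-pendant ⟩
      ∑ L (imbalance L j) + L ∎
    where
    open ≡-Reasoning
    column : ∀ t → t < suc L → ∑ N (λ a → edgeTerm a (suc t)) ≡ edgeImbalance (suc t)
    column t t<1+L = trans
      (∑-cong N (λ a _ → cong (λ c → if c then edgeImbalance (suc t) else 0)
                              (isEdgeUp≡isParent a (suc t) (s≤s z≤n) (s≤s t<1+L))))
      (∑-indicator N (parent (suc t)) (edgeImbalance (suc t))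
                   (<-trans (proj₁ (parent-neighbour (suc t) (s≤s z≤n) (s≤s t<1+L))) (s≤s t<1+L)))

  mostar : Mostar T ≡ ∑ L (imbalance L j) + L
  mostar = trans Mostar≡∑edgeTerm ∑edgeTerm

≤ᵇ-suc-away : ∀ j t → t ≢ j → (suc j ≤ᵇ t) ≡ (j ≤ᵇ t)
≤ᵇ-suc-away j t t≢j with <-cmp t j
... | tri< t<j _ _ = trans (≤ᵇ-false {suc j} {t} (≤-trans t<j (n≤1+n j))) (sym (≤ᵇ-false t<j))
... | tri≈ _ t≡j _ = ⊥-elim (t≢j t≡j)
... | tri> _ _ j<t = trans (≤ᵇ-true {suc j} {t} j<t) (sym (≤ᵇ-true (<⇒≤ j<t)))

<ᵇ-suc-away : ∀ j t → t ≢ j → (t <ᵇ suc j) ≡ (t <ᵇ j)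
<ᵇ-suc-away j t t≢j with <-cmp t j
... | tri< t<j _ _ = trans (<ᵇ-true {t} {suc j} (≤-trans t<j (n≤1+n j))) (sym (<ᵇ-true t<j))
... | tri≈ _ t≡j _ = ⊥-elim (t≢j t≡j)
... | tri> _ _ j<t = trans (<ᵇ-false {t} {suc j} j<t) (sym (<ᵇ-false (<⇒≤ j<t)))

imbalance-away : ∀ L j t → t ≢ j → imbalance L (suc j) t ≡ imbalance L j t
imbalance-away L j t t≢j rewrite ≤ᵇ-suc-away j t t≢j | <ᵇ-suc-away j t t≢j = refl

-- Written with L = j + (2 + j + r), so that no truncated subtraction remains.
imbalance-at : ∀ j r → let L = j + suc (suc (j + r)) in imbalance L (suc j) j ≡ imbalance L j j + 2
imbalance-at j r = trans before (trans (+-comm 2 r) (cong (_+ 2) (sym after)))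
  where
  open ≡-Reasoning
  M : ℕ
  M = suc (suc (j + r))
  M≡j+2+r : M ≡ j + suc (suc r)
  M≡j+2+r = sym (trans (+-suc j (suc r)) (cong suc (+-suc j r)))
  before : imbalance (j + M) (suc j) j ≡ suc (suc r)
  before = begin
      ∣ (suc j + 𝟙 (j <ᵇ j)) - ((j + M ∸ j) + 𝟙 (j <ᵇ suc j)) ∣
    ≡⟨ cong₂ ∣_-_∣ (cong (λ b → suc j + 𝟙 b) (<ᵇ-false {j} {j} ≤-refl))
                   (cong₂ _+_ (m+n∸m≡n j M) (cong 𝟙 (<ᵇ-true {j} {suc j} ≤-refl))) ⟩
      ∣ (suc j + 0) - (M + 1) ∣
    ≡⟨ cong₂ ∣_-_∣ (+-identityʳ (suc j)) (+-comm M 1) ⟩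
      ∣ j - M ∣
    ≡⟨ cong (λ z → ∣ j - z ∣) M≡j+2+r ⟩
      ∣ j - j + suc (suc r) ∣
    ≡⟨ ∣m-m+n∣≡n j (suc (suc r)) ⟩
      suc (suc r) ∎
  after : imbalance (j + M) j j ≡ r
  after = begin
      ∣ (suc j + 𝟙 (j ≤ᵇ j)) - ((j + M ∸ j) + 𝟙 (j <ᵇ j)) ∣
    ≡⟨ cong₂ ∣_-_∣ (cong (λ b → suc j + 𝟙 b) (≤ᵇ-true {j} {j} ≤-refl))
                   (cong₂ _+_ (m+n∸m≡n j M) (cong 𝟙 (<ᵇ-false {j} {j} ≤-refl))) ⟩
      ∣ (suc j + 1) - (M + 0) ∣
    ≡⟨ cong₂ ∣_-_∣ (+-comm (suc j) 1) (+-identityʳ M) ⟩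
      ∣ j - j + r ∣
    ≡⟨ ∣m-m+n∣≡n j r ⟩
      r ∎

∑imbalance-suc : ∀ L j → suc (suc (j + j)) ≤ L → ∑ L (imbalance L (suc j)) ≡ ∑ L (imbalance L j) + 2
∑imbalance-suc L j 2+2j≤L = ∑-update L (imbalance L (suc j)) (imbalance L j) j 2 j<L
  (λ t _ t≢j → imbalance-away L j t t≢j) at-j
  where
  j<L : j < L
  j<L = ≤-trans (s≤s (m≤m+n j j)) (≤-trans (n≤1+n _) 2+2j≤L)
  at-j : imbalance L (suc j) j ≡ imbalance L j j + 2
  at-j with m≤n⇒∃[o]m+o≡n 2+2j≤L
  ... | r , refl rewrite solve 2 (λ j r → con 2 :+ (j :+ j) :+ r := j :+ (con 2 :+ (j :+ r))) refl j r =
    imbalance-at j r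

pathImbalance : ℕ → ℕ
pathImbalance L = ∑ L (λ t → ∣ suc (suc t) - (L ∸ t) ∣)

∑imbalance : ∀ L j → j + j ≤ L → ∑ L (imbalance L j) ≡ pathImbalance L + (j + j)
∑imbalance L zero _ = trans (∑-cong L (λ t _ → cong₂ ∣_-_∣ (+-comm (suc t) 1) (+-identityʳ (L ∸ t))))
                            (sym (+-identityʳ (pathImbalance L)))
∑imbalance L (suc j) 2+2j≤L = begin
    ∑ L (imbalance L (suc j))
  ≡⟨ ∑imbalance-suc L j 2+2j≤L′ ⟩
    ∑ L (imbalance L j) + 2
  ≡⟨ cong (_+ 2) (∑imbalance L j (≤-trans (m≤n+m (j + j) 2) 2+2j≤L′)) ⟩
    pathImbalance L + (j + j) + 2
  ≡⟨ solve 2 (λ a e → a :+ e :+ con 2 := a :+ (con 2 :+ e)) refl (pathImbalance L) (j + j) ⟩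
    pathImbalance L + suc (suc (j + j))
  ≡⟨ cong (λ z → pathImbalance L + suc z) (sym (+-suc j j)) ⟩
    pathImbalance L + (suc j + suc j) ∎
  where
  open ≡-Reasoning
  2+2j≤L′ : suc (suc (j + j)) ≤ L
  2+2j≤L′ = subst (_≤ L) (cong suc (+-suc j j)) 2+2j≤L

pathImbalance-+2 : ∀ L → pathImbalance (suc (suc L)) ≡ pathImbalance L + (L + suc (suc L))
pathImbalance-+2 L = begin
    L + ∑ (suc L) (λ t → ∣ suc (suc (suc t)) - (suc L ∸ t) ∣)
  ≡⟨ cong (L +_) (∑-snoc L (λ t → ∣ suc (suc (suc t)) - (suc L ∸ t) ∣)) ⟩
    L + (∑ L (λ t → ∣ suc (suc (suc t)) - (suc L ∸ t) ∣) + ∣ suc (suc (suc L)) - (suc L ∸ L) ∣)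
  ≡⟨ cong₂ (λ a b → L + (a + b)) (∑-cong L shifted) last-edge ⟩
    L + (pathImbalance L + suc (suc L))
  ≡⟨ solve 2 (λ L a → L :+ (a :+ (con 2 :+ L)) := a :+ (L :+ (con 2 :+ L))) refl L (pathImbalance L) ⟩
    pathImbalance L + (L + suc (suc L)) ∎
  where
  open ≡-Reasoning
  shifted : ∀ t → t < L → ∣ suc (suc (suc t)) - (suc L ∸ t) ∣ ≡ ∣ suc (suc t) - (L ∸ t) ∣
  shifted t t<L rewrite +-∸-assoc 1 (<⇒≤ t<L) = refl
  last-edge : ∣ suc (suc (suc L)) - (suc L ∸ L) ∣ ≡ suc (suc L)
  last-edge rewrite +-∸-assoc 1 (≤-refl {L}) | n∸n≡0 L = ∣-∣-identityʳ (suc (suc L))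

pathImbalance-odd : ∀ j → pathImbalance (suc (j + j)) ≡ pathImbalance (j + j) + suc (j + j)
pathImbalance-odd zero    = refl
pathImbalance-odd (suc j) rewrite +-suc j j = begin
    pathImbalance (suc (suc (suc e)))
  ≡⟨ pathImbalance-+2 (suc e) ⟩
    pathImbalance (suc e) + (suc e + suc (suc (suc e)))
  ≡⟨ cong (_+ (suc e + suc (suc (suc e)))) (pathImbalance-odd j) ⟩
    pathImbalance e + suc e + (suc e + suc (suc (suc e)))
  ≡⟨ solve 2 (λ a e → a :+ (con 1 :+ e) :+ ((con 1 :+ e) :+ (con 3 :+ e))
                   := a :+ (e :+ (con 2 :+ e)) :+ (con 3 :+ e)) refl (pathImbalance e) e ⟩
    pathImbalance e + (e + suc (suc e)) + suc (suc (suc e))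
  ≡⟨ cong (_+ suc (suc (suc e))) (sym (pathImbalance-+2 e)) ⟩
    pathImbalance (suc (suc e)) + suc (suc (suc e)) ∎
  where
  open ≡-Reasoning
  e : ℕ
  e = j + j

pathImbalance-even : ∀ j → pathImbalance (suc (suc (j + j))) ≡ pathImbalance (suc (j + j)) + suc (j + j)
pathImbalance-even j = begin
    pathImbalance (suc (suc e))
  ≡⟨ pathImbalance-+2 e ⟩
    pathImbalance e + (e + suc (suc e))
  ≡⟨ solve 2 (λ a e → a :+ (e :+ (con 2 :+ e)) := a :+ (con 1 :+ e) :+ (con 1 :+ e)) refl (pathImbalance e) e ⟩
    pathImbalance e + suc e + suc e
  ≡⟨ cong (_+ suc e) (sym (pathImbalance-odd j)) ⟩
    pathImbalance (suc e) + suc e ∎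
  where
  open ≡-Reasoning
  e : ℕ
  e = j + j

mostarValue : ℕ → ℕ → ℕ
mostarValue L j = pathImbalance L + L + (j + j)

mostarValue-suc : ∀ L j → mostarValue L (suc j) ≡ suc (suc (mostarValue L j))
mostarValue-suc L j rewrite +-suc j j =
  trans (+-suc (pathImbalance L + L) (suc (j + j))) (cong suc (+-suc (pathImbalance L + L) (j + j)))

mostarValue-even-L : ∀ j → mostarValue (suc (j + j)) 0 ≡ suc (suc (mostarValue (j + j) j))
mostarValue-even-L j rewrite pathImbalance-odd j =
  solve 2 (λ a e → a :+ (con 1 :+ e) :+ (con 1 :+ e) :+ con 0 := con 2 :+ (a :+ e :+ e)) refl
    (pathImbalance (j + j)) (j + j)

mostarValue-odd-L : ∀ j → mostarValue (suc (suc (j + j))) 0 ≡ suc (suc (mostarValue (suc (j + j)) j))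
mostarValue-odd-L j rewrite pathImbalance-even j =
  solve 2 (λ a e → a :+ (con 1 :+ e) :+ (con 2 :+ e) :+ con 0 := con 2 :+ (a :+ (con 1 :+ e) :+ e)) refl
    (pathImbalance (suc (j + j))) (j + j)

mostarValue-covers-evens : ∀ k → Σ ℕ λ L → Σ ℕ λ j → (j + j ≤ L) × (mostarValue L j ≡ k + k)
mostarValue-covers-evens zero = 0 , 0 , z≤n , refl
mostarValue-covers-evens (suc k) with mostarValue-covers-evens k
... | L , j , 2j≤L , value rewrite +-suc k k with suc (suc (j + j)) ≤? L
...   | yes 2+2j≤L = L , suc j , subst (_≤ L) (sym (cong suc (+-suc j j))) 2+2j≤L ,
                     trans (mostarValue-suc L j) (cong (λ v → suc (suc v)) value)
...   | no 2+2j≰L with m≤n⇒m<n∨m≡n 2j≤L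
...     | inj₂ refl = suc L , 0 , z≤n , trans (mostarValue-even-L j) (cong (λ v → suc (suc v)) value)
...     | inj₁ 2j<L with ≤-antisym (≤-pred (≰⇒> 2+2j≰L)) 2j<L
...       | refl = suc L , 0 , z≤n , trans (mostarValue-odd-L j) (cong (λ v → suc (suc v)) value)

mainTheorem9 : (p : ℕ) → (Σ ℕ λ k → p ≡ 2 * k) →
    Σ ℕ λ n → Σ (Graph n) λ T → IsTree T × Mostar T ≡ p
mainTheorem9 p (k , p≡2k) with mostarValue-covers-evens k
... | L , j , 2j≤L , value = N , T , isTree , (begin
    Mostar T                           ≡⟨ mostar ⟩
    ∑ L (imbalance L j) + L            ≡⟨ cong (_+ L) (∑imbalance L j 2j≤L) ⟩
    pathImbalance L + (j + j) + L      ≡⟨ xy∙z≈xz∙y (pathImbalance L) (j + j) L ⟩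
    mostarValue L j                    ≡⟨ value ⟩
    k + k                              ≡⟨ cong (k +_) (sym (+-identityʳ k)) ⟩
    2 * k                              ≡⟨ sym p≡2k ⟩
    p                                  ∎)
  where
  open PathWithPendant L j (≤-trans (m≤m+n j j) 2j≤L)
  open ≡-Reasoning
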